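{- If $a_3\geq 9$ and $a_3\equiv 3\bmod 6$, then the triple $(2,3,a_3)$ is perfect.
   Context: For a graph $G$, the $3$-neighbour bootstrap process starts from a set $A_0\subseteq V(G)$ and, for $t\ge1$, sets $A_t=A_{t-1}\cup\{v: |N_G(v)\cap A_{t-1}|\ge 3\}$; $A_0$ percolates if $\bigcup_t A_t=V(G)$. For positive integers $a_1,a_2,a_3$, $[a_1]\times[a_2]\times[a_3]$ denotes the grid graph (vertices adjacent iff they differ by exactly 1 in exactly one coordinate), and $m(a_1,a_2,a_3;3)$ is the minimum size of a percolating set for the $3$-neighbour process in it. A triple $(a_1,a_2,a_3)$ of positive integers is called perfect if $a_1a_2+a_1a_3+a_2a_3\equiv 0\pmod 3$ and $m(a_1,a_2,a_3;3)=\frac{a_1a_2+a_1a_3+a_2a_3}{3}$. -}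

module Defs where

open import Data.Nat using (ℕ; zero; suc; _+_; _*_; _≤_; _≥_; _≡ᵇ_)
open import Data.Nat.Divisibility using (_∣_)
open import Data.Nat.DivMod using (_/_)
open import Data.Bool using (Bool; true; false; _∧_; _∨_; if_then_else_)
open import Data.Fin using (Fin; toℕ)
open import Data.List using (List; []; _∷_; length; filter; concatMap; map; allFin)
open import Data.Product using (_×_; _,_; Σ; ∃; ∃-syntax)
open import Relation.Binary.PropositionalEquality using (_≡_)
open import Relation.Nullary.Decidable using (does)
open import Relation.Unary using (Pred)
open import Data.Bool.Properties using () renaming (_≟_ to _≟B_)

-- Vertices of the grid graph [a1] × [a2] × [a3]
-- (coordinates 0..a_i-1; the shift from 1..a_i is irrelevant).
Vertex : ℕ → ℕ → ℕ → Set
Vertex a₁ a₂ a₃ = Fin a₁ × Fin a₂ × Fin a₃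

vertices : (a₁ a₂ a₃ : ℕ) → List (Vertex a₁ a₂ a₃)
vertices a₁ a₂ a₃ =
  concatMap (λ i → concatMap (λ j → map (λ k → (i , j , k)) (allFin a₃)) (allFin a₂)) (allFin a₁)

dist1 : ℕ → ℕ → Bool
dist1 x y = (x ≡ᵇ suc y) ∨ (y ≡ᵇ suc x)

adj : ∀ {a₁ a₂ a₃} → Vertex a₁ a₂ a₃ → Vertex a₁ a₂ a₃ → Bool
adj (x₁ , x₂ , x₃) (y₁ , y₂ , y₃) =
     (dist1 (toℕ x₁) (toℕ y₁) ∧ (toℕ x₂ ≡ᵇ toℕ y₂) ∧ (toℕ x₃ ≡ᵇ toℕ y₃))
  ∨ ((toℕ x₁ ≡ᵇ toℕ y₁) ∧ dist1 (toℕ x₂) (toℕ y₂) ∧ (toℕ x₃ ≡ᵇ toℕ y₃))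
  ∨ ((toℕ x₁ ≡ᵇ toℕ y₁) ∧ (toℕ x₂ ≡ᵇ toℕ y₂) ∧ dist1 (toℕ x₃) (toℕ y₃))

VSet : ℕ → ℕ → ℕ → Set
VSet a₁ a₂ a₃ = Vertex a₁ a₂ a₃ → Bool

size : ∀ {a₁ a₂ a₃} → VSet a₁ a₂ a₃ → ℕ
size {a₁} {a₂} {a₃} A = length (filter (λ v → A v ≟B true) (vertices a₁ a₂ a₃))

nbrsIn : ∀ {a₁ a₂ a₃} → VSet a₁ a₂ a₃ → Vertex a₁ a₂ a₃ → ℕ
nbrsIn {a₁} {a₂} {a₃} A v =
  length (filter (λ w → (adj v w ∧ A w) ≟B true) (vertices a₁ a₂ a₃))

three≤ : ℕ → Bool
three≤ (suc (suc (suc _))) = true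
three≤ _ = false

step : ∀ {a₁ a₂ a₃} → VSet a₁ a₂ a₃ → VSet a₁ a₂ a₃
step A v = A v ∨ three≤ (nbrsIn A v)

iter : ∀ {a₁ a₂ a₃} → ℕ → VSet a₁ a₂ a₃ → VSet a₁ a₂ a₃
iter zero A = A
iter (suc t) A = step (iter t A)

Percolates : ∀ {a₁ a₂ a₃} → VSet a₁ a₂ a₃ → Set
Percolates {a₁} {a₂} {a₃} A = (v : Vertex a₁ a₂ a₃) → ∃[ t ] (iter t A v ≡ true)

IsMinPercSize : ℕ → ℕ → ℕ → ℕ → Set
IsMinPercSize a₁ a₂ a₃ m =
  (∃[ A ] (Percolates {a₁} {a₂} {a₃} A × size A ≡ m))
  × ((A : VSet a₁ a₂ a₃) → Percolates A → m ≤ size A)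

Perfect : ℕ → ℕ → ℕ → Set
Perfect a₁ a₂ a₃ =
  (3 ∣ (a₁ * a₂ + a₁ * a₃ + a₂ * a₃))
  × IsMinPercSize a₁ a₂ a₃ ((a₁ * a₂ + a₁ * a₃ + a₂ * a₃) / 3)

{-# OPTIONS --safe #-}
module Submission where

open import Defs
open import Data.Nat using (ℕ; _≥_; _%_)
open import Relation.Binary.PropositionalEquality using (_≡_)

-- Lower bound, for any grid [a₁] × [a₂] × [a₃]: view the vertices as unit cubes. The surface area
-- 6|X| − 2e(X) of the infected set never increases, since a vertex joins X only when at least three of its
-- neighbours are in X, which changes the area by 6 − 2·deg_X ≤ 0. The whole grid has surface area
-- 2(a₁a₂ + a₁a₃ + a₂a₃), so a percolating set has at least (a₁a₂ + a₁a₃ + a₂a₃)/3 vertices.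
--
-- Upper bound for (2, 3, 9 + 6r): an explicit set of 17 + 10r vertices, made of a bottom layer, a block of six
-- layers repeated r + 1 times and two top layers. It percolates by finite infection sequences, checked by
-- evaluation inside windows of at most eight layers and translated along the long axis: one window starts the
-- sweep, one advances it by a block, one finishes the top, and one fills the corner column (0, 2) downwards.

open import Data.Bool using (Bool; true; false; _∧_; _∨_; T; if_then_else_)
open import Data.Bool.Properties using (∨-comm; ∨-zeroʳ; ∨-identityʳ; ∧-zeroʳ; ∧-identityʳ) renaming (_≟_ to _≟B_)
open import Data.Empty using (⊥; ⊥-elim)
open import Data.Fin using (Fin; toℕ; fromℕ<) renaming (zero to fzero; suc to fsuc)
import Data.Fin.Properties as Fin
open import Data.List using (List; []; _∷_; _++_; length; filter; map; concatMap; allFin; tabulate)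
open import Data.List.Membership.Propositional using (_∈_; lose)
open import Data.List.Membership.Propositional.Properties using (∈-concatMap⁺; ∈-map⁺; ∈-allFin)
open import Data.List.Relation.Unary.All using (All; []; _∷_; all?)
import Data.List.Relation.Unary.All as All
import Data.List.Relation.Unary.All.Properties as All
open import Data.List.Relation.Unary.Any using (here; there)
import Data.Nat as ℕ
open import Data.Nat using (zero; suc; _+_; _*_; _∸_; _⊔_; _≤_; _<_; _≤′_; ≤′-refl; ≤′-step; _≡ᵇ_; z≤n; s≤s; s≤s⁻¹; _/_)
open import Data.Nat.DivMod using (m≡m%n+[m/n]*n; m*n/n≡m)
open import Data.Nat.Divisibility using (divides)
open import Data.Nat.Properties
open import Data.Nat.Tactic.RingSolver using (solve-∀)
open import Data.Product using (_×_; _,_; proj₁; proj₂; ∃-syntax)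
open import Data.Product.Properties using (≡-dec)
open import Data.Sum using (inj₁; inj₂)
open import Data.Unit using (⊤; tt)
open import Function using (_∘_; id)
open import Function.Bundles using (mk⇔)
open import Relation.Binary.Definitions using (DecidableEquality)
open import Relation.Binary.PropositionalEquality using (_≢_; refl; sym; trans; cong; cong₂; subst; subst₂; module ≡-Reasoning)
open import Relation.Nullary using (¬?; Dec; yes; no; does; contradiction)
open import Relation.Nullary.Decidable using (True; toWitness; map′; _×-dec_; dec-true; dec-false; does-⇔)

open import Algebra.Properties.Semiring.Sum +-*-semiring
  using (sum; sum-syntax; sum-cong-≗; ∑-distrib-+; ∑-comm; *-distribˡ-sum; *-distribʳ-sum)

𝟙 : Bool → ℕ
𝟙 true  = 1
𝟙 false = 0

𝟙-∧ : ∀ p q → 𝟙 (p ∧ q) ≡ 𝟙 p * 𝟙 q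
𝟙-∧ true  q = sym (+-identityʳ (𝟙 q))
𝟙-∧ false q = refl

𝟙-∨-disjoint : ∀ p q → (p ≡ true → q ≡ true → ⊥) → 𝟙 (p ∨ q) ≡ 𝟙 p + 𝟙 q
𝟙-∨-disjoint true  true  p∧q = ⊥-elim (p∧q refl refl)
𝟙-∨-disjoint true  false _   = refl
𝟙-∨-disjoint false q     _   = refl

∧-true : ∀ {p q} → p ∧ q ≡ true → p ≡ true × q ≡ true
∧-true {true} {true} _ = refl , refl

∧∨∧-true : ∀ a b c → (a ∧ b) ∨ (a ∧ c) ≡ true → a ≡ true
∧∨∧-true true _ _ _ = refl

𝟙-∧³ : ∀ a b c → 𝟙 (a ∧ b ∧ c) ≡ 𝟙 a * (𝟙 b * 𝟙 c)
𝟙-∧³ a b c = trans (𝟙-∧ a (b ∧ c)) (cong (𝟙 a *_) (𝟙-∧ b c))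

𝟙-∧-mono : ∀ a {b c} → (b ≡ true → c ≡ true) → 𝟙 (a ∧ b) ≤ 𝟙 (a ∧ c)
𝟙-∧-mono false         _   = z≤n
𝟙-∧-mono true  {false} _   = z≤n
𝟙-∧-mono true  {true}  b⇒c rewrite b⇒c refl = ≤-refl

𝟙*-≤ : ∀ b m → 𝟙 b * m ≤ m
𝟙*-≤ true  m = ≤-reflexive (+-identityʳ m)
𝟙*-≤ false m = z≤n

∑-zero : ∀ n → ∑[ i < n ] 0 ≡ 0
∑-zero zero    = refl
∑-zero (suc n) = ∑-zero n

∑-const : ∀ n c → ∑[ i < n ] c ≡ n * c
∑-const zero    c = refl
∑-const (suc n) c = cong (c +_) (∑-const n c)

∑-mono-≤ : ∀ {n} {f g : Fin n → ℕ} → (∀ i → f i ≤ g i) → sum f ≤ sum g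
∑-mono-≤ {zero}  _   = z≤n
∑-mono-≤ {suc n} f≤g = +-mono-≤ (f≤g fzero) (∑-mono-≤ (f≤g ∘ fsuc))

∑-*ˡ : ∀ {n} c (f : Fin n → ℕ) → ∑[ i < n ] (c * f i) ≡ c * sum f
∑-*ˡ c f = sym (*-distribˡ-sum c f)

δ : ∀ {n} → Fin n → Fin n → ℕ
δ i x = 𝟙 (does (i Fin.≟ x))

∑-select : ∀ {n} (x : Fin n) (f : Fin n → ℕ) → ∑[ i < n ] (δ i x * f i) ≡ f x
∑-select {suc n} fzero    f = trans (cong₂ _+_ (+-identityʳ (f fzero)) (∑-zero n)) (+-identityʳ (f fzero))
∑-select {suc n} (fsuc x) f = ∑-select x (f ∘ fsuc)

∑-*ʳ : ∀ {n} c (f : Fin n → ℕ) → ∑[ i < n ] (f i * c) ≡ sum f * c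
∑-*ʳ c f = sym (*-distribʳ-sum c f)

∑³-product : ∀ {l m n} (f : Fin l → ℕ) (g : Fin m → ℕ) (h : Fin n → ℕ) →
             ∑[ i < l ] ∑[ j < m ] ∑[ k < n ] (f i * (g j * h k)) ≡ sum f * (sum g * sum h)
∑³-product f g h =
  trans (sum-cong-≗ λ i → trans (sum-cong-≗ λ j → trans (∑-*ˡ (f i) λ k → g j * h k) (cong (f i *_) (∑-*ˡ (g j) h)))
                                 (trans (∑-*ˡ (f i) λ j → g j * sum h) (cong (f i *_) (∑-*ʳ (sum h) g))))
        (∑-*ʳ (sum g * sum h) f)

∑ˡ : ∀ {X : Set} → (X → ℕ) → List X → ℕ
∑ˡ f []       = 0
∑ˡ f (x ∷ xs) = f x + ∑ˡ f xs

length-filter≡∑ˡ : ∀ {X : Set} (p : X → Bool) xs →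
                   length (filter (λ x → p x ≟B true) xs) ≡ ∑ˡ (𝟙 ∘ p) xs
length-filter≡∑ˡ p []       = refl
length-filter≡∑ˡ p (x ∷ xs) with p x
... | true  = cong suc (length-filter≡∑ˡ p xs)
... | false = length-filter≡∑ˡ p xs

∑ˡ-++ : ∀ {X : Set} (f : X → ℕ) xs ys → ∑ˡ f (xs ++ ys) ≡ ∑ˡ f xs + ∑ˡ f ys
∑ˡ-++ f []       ys = refl
∑ˡ-++ f (x ∷ xs) ys = trans (cong (f x +_) (∑ˡ-++ f xs ys)) (sym (+-assoc (f x) _ _))

∑ˡ-concatMap : ∀ {X Y : Set} (f : Y → ℕ) (g : X → List Y) xs → ∑ˡ f (concatMap g xs) ≡ ∑ˡ (∑ˡ f ∘ g) xs
∑ˡ-concatMap f g []       = refl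
∑ˡ-concatMap f g (x ∷ xs) = trans (∑ˡ-++ f (g x) _) (cong (∑ˡ f (g x) +_) (∑ˡ-concatMap f g xs))

∑ˡ-map : ∀ {X Y : Set} (f : Y → ℕ) (g : X → Y) xs → ∑ˡ f (map g xs) ≡ ∑ˡ (f ∘ g) xs
∑ˡ-map f g []       = refl
∑ˡ-map f g (x ∷ xs) = cong (f (g x) +_) (∑ˡ-map f g xs)

∑ˡ-tabulate : ∀ {X : Set} {n} (f : X → ℕ) (g : Fin n → X) → ∑ˡ f (tabulate g) ≡ ∑[ i < n ] f (g i)
∑ˡ-tabulate {n = zero}  f g = refl
∑ˡ-tabulate {n = suc n} f g = cong (f (g fzero) +_) (∑ˡ-tabulate f (g ∘ fsuc))

module _ {a₁ a₂ a₃ : ℕ} where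

  ∑ᵥ : (Vertex a₁ a₂ a₃ → ℕ) → ℕ
  ∑ᵥ f = ∑[ i < a₁ ] ∑[ j < a₂ ] ∑[ k < a₃ ] f (i , j , k)

  ∑ᵥ-cong : ∀ {f g : Vertex a₁ a₂ a₃ → ℕ} → (∀ v → f v ≡ g v) → ∑ᵥ f ≡ ∑ᵥ g
  ∑ᵥ-cong f≗g = sum-cong-≗ λ i → sum-cong-≗ λ j → sum-cong-≗ λ k → f≗g (i , j , k)

  ∑ᵥ-distrib-+ : ∀ (f g : Vertex a₁ a₂ a₃ → ℕ) → ∑ᵥ (λ v → f v + g v) ≡ ∑ᵥ f + ∑ᵥ g
  ∑ᵥ-distrib-+ f g =
    trans (sum-cong-≗ λ i → trans (sum-cong-≗ λ j → ∑-distrib-+ (f₃ i j) (g₃ i j)) (∑-distrib-+ (f₂ i) (g₂ i)))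
          (∑-distrib-+ (λ i → sum (f₂ i)) (λ i → sum (g₂ i)))
    where
    f₃ g₃ : Fin a₁ → Fin a₂ → Fin a₃ → ℕ
    f₃ i j k = f (i , j , k)
    g₃ i j k = g (i , j , k)
    f₂ g₂ : Fin a₁ → Fin a₂ → ℕ
    f₂ i j = sum (f₃ i j)
    g₂ i j = sum (g₃ i j)

  ∑ᵥ-mono-≤ : ∀ {f g : Vertex a₁ a₂ a₃ → ℕ} → (∀ v → f v ≤ g v) → ∑ᵥ f ≤ ∑ᵥ g
  ∑ᵥ-mono-≤ f≤g = ∑-mono-≤ λ i → ∑-mono-≤ λ j → ∑-mono-≤ λ k → f≤g (i , j , k)

  _≟ᵥ_ : DecidableEquality (Vertex a₁ a₂ a₃)
  (i , j , k) ≟ᵥ (i′ , j′ , k′) =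
    map′ (λ { (refl , refl , refl) → refl }) (λ { refl → refl , refl , refl })
         (i Fin.≟ i′ ×-dec j Fin.≟ j′ ×-dec k Fin.≟ k′)

  δᵥ : Vertex a₁ a₂ a₃ → Vertex a₁ a₂ a₃ → ℕ
  δᵥ w v = 𝟙 (does (w ≟ᵥ v))

  ∑ᵥ-select : ∀ (f : Vertex a₁ a₂ a₃ → ℕ) v → ∑ᵥ (λ w → δᵥ w v * f w) ≡ f v
  ∑ᵥ-select f (x₁ , x₂ , x₃) = begin
    ∑ᵥ (λ w → δᵥ w (x₁ , x₂ , x₃) * f w)
      ≡⟨ ∑ᵥ-cong factorise ⟩
    ∑[ i < a₁ ] ∑[ j < a₂ ] ∑[ k < a₃ ] (δ i x₁ * (δ j x₂ * (δ k x₃ * f (i , j , k))))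
      ≡⟨ sum-cong-≗ (λ i → sum-cong-≗ λ j →
           trans (∑-*ˡ (δ i x₁) λ k → δ j x₂ * (δ k x₃ * f (i , j , k)))
                 (cong (δ i x₁ *_) (trans (∑-*ˡ (δ j x₂) λ k → δ k x₃ * f (i , j , k))
                                          (cong (δ j x₂ *_) (∑-select x₃ λ k → f (i , j , k)))))) ⟩
    ∑[ i < a₁ ] ∑[ j < a₂ ] (δ i x₁ * (δ j x₂ * f (i , j , x₃)))
      ≡⟨ sum-cong-≗ (λ i → trans (∑-*ˡ (δ i x₁) λ j → δ j x₂ * f (i , j , x₃))
                                 (cong (δ i x₁ *_) (∑-select x₂ λ j → f (i , j , x₃)))) ⟩
    ∑[ i < a₁ ] (δ i x₁ * f (i , x₂ , x₃))
      ≡⟨ ∑-select x₁ (λ i → f (i , x₂ , x₃)) ⟩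
    f (x₁ , x₂ , x₃) ∎
    where
    open ≡-Reasoning
    factorise : ∀ w → δᵥ w (x₁ , x₂ , x₃) * f w ≡
                      δ (proj₁ w) x₁ * (δ (proj₁ (proj₂ w)) x₂ * (δ (proj₂ (proj₂ w)) x₃ * f w))
    factorise (i , j , k) = begin
      𝟙 (does (i Fin.≟ x₁) ∧ (does (j Fin.≟ x₂) ∧ does (k Fin.≟ x₃))) * f (i , j , k)
        ≡⟨ cong (_* f (i , j , k)) (trans (𝟙-∧ (does (i Fin.≟ x₁)) _)
                                         (cong (δ i x₁ *_) (𝟙-∧ (does (j Fin.≟ x₂)) (does (k Fin.≟ x₃))))) ⟩
      δ i x₁ * (δ j x₂ * δ k x₃) * f (i , j , k)
        ≡⟨ trans (*-assoc (δ i x₁) (δ j x₂ * δ k x₃) _) (cong (δ i x₁ *_) (*-assoc (δ j x₂) (δ k x₃) _)) ⟩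
      δ i x₁ * (δ j x₂ * (δ k x₃ * f (i , j , k))) ∎

  ∑ᵥ-δᵥ : ∀ v → ∑ᵥ (λ w → δᵥ w v) ≡ 1
  ∑ᵥ-δᵥ v = trans (∑ᵥ-cong λ w → sym (*-identityʳ (δᵥ w v))) (∑ᵥ-select (λ _ → 1) v)

  ∑ᵥ-≥ : ∀ (f : Vertex a₁ a₂ a₃ → ℕ) v → f v ≤ ∑ᵥ f
  ∑ᵥ-≥ f v = subst (_≤ ∑ᵥ f) (∑ᵥ-select f v) (∑ᵥ-mono-≤ λ w → 𝟙*-≤ (does (w ≟ᵥ v)) (f w))

  3≤∑ᵥ𝟙 : ∀ (p : Vertex a₁ a₂ a₃ → Bool) {x y z} → x ≢ y → x ≢ z → y ≢ z →
          p x ≡ true → p y ≡ true → p z ≡ true → 3 ≤ ∑ᵥ (𝟙 ∘ p)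
  3≤∑ᵥ𝟙 p {x} {y} {z} x≢y x≢z y≢z px py pz = begin
    3                                              ≡⟨ cong₂ _+_ (cong₂ _+_ (∑ᵥ-δᵥ x) (∑ᵥ-δᵥ y)) (∑ᵥ-δᵥ z) ⟨
    ∑ᵥ (λ w → δᵥ w x) + ∑ᵥ (λ w → δᵥ w y) + ∑ᵥ (λ w → δᵥ w z)
                                                   ≡⟨ trans (∑ᵥ-distrib-+ (λ w → δᵥ w x + δᵥ w y) (λ w → δᵥ w z))
                                                           (cong (_+ _) (∑ᵥ-distrib-+ (λ w → δᵥ w x) (λ w → δᵥ w y))) ⟨
    ∑ᵥ (λ w → δᵥ w x + δᵥ w y + δᵥ w z)            ≤⟨ ∑ᵥ-mono-≤ pointwise ⟩
    ∑ᵥ (𝟙 ∘ p)                                     ∎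
    where
    open ≤-Reasoning
    pointwise : ∀ w → δᵥ w x + δᵥ w y + δᵥ w z ≤ 𝟙 (p w)
    pointwise w = bound (w ≟ᵥ x) (w ≟ᵥ y) (w ≟ᵥ z)
      where
      bound : (dx : Dec (w ≡ x)) (dy : Dec (w ≡ y)) (dz : Dec (w ≡ z)) →
              𝟙 (does dx) + 𝟙 (does dy) + 𝟙 (does dz) ≤ 𝟙 (p w)
      bound (yes refl) (yes refl) _          = ⊥-elim (x≢y refl)
      bound (yes refl) (no _)     (yes refl) = ⊥-elim (x≢z refl)
      bound (no _)     (yes refl) (yes refl) = ⊥-elim (y≢z refl)
      bound (yes refl) (no _)     (no _)     = ≤-reflexive (cong 𝟙 (sym px))
      bound (no _)     (yes refl) (no _)     = ≤-reflexive (cong 𝟙 (sym py))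
      bound (no _)     (no _)     (yes refl) = ≤-reflexive (cong 𝟙 (sym pz))
      bound (no _)     (no _)     (no _)     = z≤n

  ∑ˡ-vertices : ∀ (f : Vertex a₁ a₂ a₃ → ℕ) → ∑ˡ f (vertices a₁ a₂ a₃) ≡ ∑ᵥ f
  ∑ˡ-vertices f =
    trans (∑ˡ-concatMap f plane (allFin a₁)) (trans (∑ˡ-tabulate (∑ˡ f ∘ plane) id) (sum-cong-≗ λ i →
    trans (∑ˡ-concatMap f (line i) (allFin a₂)) (trans (∑ˡ-tabulate (∑ˡ f ∘ line i) id) (sum-cong-≗ λ j →
    trans (∑ˡ-map f (λ k → i , j , k) (allFin a₃)) (∑ˡ-tabulate (λ k → f (i , j , k)) id)))))
    where
    line : Fin a₁ → Fin a₂ → List (Vertex a₁ a₂ a₃)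
    line i j = map (λ k → i , j , k) (allFin a₃)
    plane : Fin a₁ → List (Vertex a₁ a₂ a₃)
    plane i = concatMap (line i) (allFin a₂)

  count : VSet a₁ a₂ a₃ → ℕ
  count B = ∑ᵥ (𝟙 ∘ B)

  degreeIn : VSet a₁ a₂ a₃ → Vertex a₁ a₂ a₃ → ℕ
  degreeIn B v = ∑ᵥ (λ w → 𝟙 (adj v w ∧ B w))

  size≡count : ∀ B → size B ≡ count B
  size≡count B = trans (length-filter≡∑ˡ B (vertices a₁ a₂ a₃)) (∑ˡ-vertices (𝟙 ∘ B))

  nbrsIn≡degreeIn : ∀ B v → nbrsIn B v ≡ degreeIn B v
  nbrsIn≡degreeIn B v = trans (length-filter≡∑ˡ (λ w → adj v w ∧ B w) (vertices a₁ a₂ a₃)) (∑ˡ-vertices _)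

three≤-true : ∀ {m} → 3 ≤ m → three≤ m ≡ true
three≤-true (s≤s (s≤s (s≤s _))) = refl

three≤-sound : ∀ {m} → three≤ m ≡ true → 3 ≤ m
three≤-sound {suc (suc (suc m))} _ = s≤s (s≤s (s≤s z≤n))

module _ {a₁ a₂ a₃ : ℕ} where

  Infected : VSet a₁ a₂ a₃ → Vertex a₁ a₂ a₃ → Set
  Infected A v = ∃[ t ] iter t A v ≡ true

  iter-mono : ∀ (A : VSet a₁ a₂ a₃) v {t u} → t ≤ u → iter t A v ≡ true → iter u A v ≡ true
  iter-mono A v t≤u = go (≤⇒≤′ t≤u)
    where
    go : ∀ {t u} → t ≤′ u → iter t A v ≡ true → iter u A v ≡ true
    go ≤′-refl                 infected = infected
    go (≤′-step {n = u} t≤′u) infected = cong (_∨ three≤ (nbrsIn (iter u A) v)) (go t≤′u infected)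

  infected-by-three : ∀ A v {x y z} → x ≢ y → x ≢ z → y ≢ z →
                      adj v x ≡ true → adj v y ≡ true → adj v z ≡ true →
                      Infected A x → Infected A y → Infected A z → Infected A v
  infected-by-three A v {x} {y} {z} x≢y x≢z y≢z vx vy vz (t₁ , ix) (t₂ , iy) (t₃ , iz) =
    suc t , trans (cong (iter t A v ∨_) (three≤-true three-neighbours)) (∨-zeroʳ (iter t A v))
    where
    t = t₁ ⊔ t₂ ⊔ t₃
    infected-neighbour : ∀ {u t′} → adj v u ≡ true → t′ ≤ t → iter t′ A u ≡ true → (adj v u ∧ iter t A u) ≡ true
    infected-neighbour {u} vu t′≤t iu rewrite vu = iter-mono A u t′≤t iu
    three-neighbours : 3 ≤ nbrsIn (iter t A) v
    three-neighbours = subst (3 ≤_) (sym (nbrsIn≡degreeIn (iter t A) v))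
      (3≤∑ᵥ𝟙 (λ w → adj v w ∧ iter t A w) x≢y x≢z y≢z
        (infected-neighbour vx (≤-trans (m≤m⊔n t₁ t₂) (m≤m⊔n (t₁ ⊔ t₂) t₃)) ix)
        (infected-neighbour vy (≤-trans (m≤n⊔m t₁ t₂) (m≤m⊔n (t₁ ⊔ t₂) t₃)) iy)
        (infected-neighbour vz (m≤n⊔m (t₁ ⊔ t₂) t₃) iz))

≡ᵇ-sym : ∀ m n → (m ≡ᵇ n) ≡ (n ≡ᵇ m)
≡ᵇ-sym m n = does-⇔ (mk⇔ sym sym) (m ℕ.≟ n) (n ℕ.≟ m)

dist1-sym : ∀ m n → dist1 m n ≡ dist1 n m
dist1-sym m n = ∨-comm (m ≡ᵇ suc n) (n ≡ᵇ suc m)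

≡ᵇ-refl : ∀ m → (m ≡ᵇ m) ≡ true
≡ᵇ-refl m = dec-true (m ℕ.≟ m) refl

dist1-irrefl : ∀ m → dist1 m m ≡ false
dist1-irrefl m = cong₂ _∨_ m≢1+m m≢1+m
  where
  m≢1+m : (m ≡ᵇ suc m) ≡ false
  m≢1+m = dec-false (m ℕ.≟ suc m) (λ eq → 1+n≢n (sym eq))

equal adjacent : ∀ {n} → Fin n → Fin n → ℕ
equal    x y = 𝟙 (toℕ x ≡ᵇ toℕ y)
adjacent x y = 𝟙 (dist1 (toℕ x) (toℕ y))

∑∑ : ∀ {n} → (Fin n → Fin n → ℕ) → ℕ
∑∑ {n} f = ∑[ x < n ] ∑[ y < n ] f x y

∑∑-equal : ∀ n → ∑∑ (equal {n}) ≡ n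
∑∑-equal n = begin
  ∑[ x < n ] ∑[ y < n ] equal x y        ≡⟨ sum-cong-≗ (λ x → sum-cong-≗ λ y → equal≡δ x y) ⟩
  ∑[ x < n ] ∑[ y < n ] (δ y x * 1)      ≡⟨ sum-cong-≗ {n} {λ x → ∑[ y < n ] (δ y x * 1)} {λ _ → 1} (λ x → ∑-select x λ _ → 1) ⟩
  ∑[ x < n ] 1                           ≡⟨ trans (∑-const n 1) (*-identityʳ n) ⟩
  n                                      ∎
  where
  open ≡-Reasoning
  equal≡δ : ∀ (x y : Fin n) → equal x y ≡ δ y x * 1
  equal≡δ x y = trans (cong 𝟙 (does-⇔ (mk⇔ (sym ∘ Fin.toℕ-injective) (cong toℕ ∘ sym)) (toℕ x ℕ.≟ toℕ y) (y Fin.≟ x)))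
                      (sym (*-identityʳ (δ y x)))

∑∑-adjacent : ∀ m → ∑∑ (adjacent {suc m}) ≡ 2 * m
∑∑-adjacent zero    = refl
∑∑-adjacent (suc m) = begin
  ∑∑ (adjacent {suc (suc m)})
    ≡⟨⟩
  ∑[ y < suc m ] 𝟙 (toℕ y ≡ᵇ 0) + ∑[ x < suc m ] (adjacent (fsuc x) fzero + ∑[ y < suc m ] adjacent (fsuc x) (fsuc y))
    ≡⟨ cong (∑[ y < suc m ] 𝟙 (toℕ y ≡ᵇ 0) +_)
            (∑-distrib-+ (λ x → adjacent (fsuc x) fzero) (λ x → ∑[ y < suc m ] adjacent (fsuc x) (fsuc y))) ⟩
  ∑[ y < suc m ] 𝟙 (toℕ y ≡ᵇ 0) + (∑[ x < suc m ] adjacent (fsuc x) fzero + ∑∑ (adjacent {suc m}))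
    ≡⟨ cong (λ s → ∑[ y < suc m ] 𝟙 (toℕ y ≡ᵇ 0) + (s + ∑∑ (adjacent {suc m})))
            (sum-cong-≗ {suc m} λ x → cong 𝟙 (∨-identityʳ (toℕ x ≡ᵇ 0))) ⟩
  ∑[ y < suc m ] 𝟙 (toℕ y ≡ᵇ 0) + (∑[ x < suc m ] 𝟙 (toℕ x ≡ᵇ 0) + ∑∑ (adjacent {suc m}))
    ≡⟨ cong₂ (λ s t → s + (t + ∑∑ (adjacent {suc m}))) (to-zero m) (to-zero m) ⟩
  1 + (1 + ∑∑ (adjacent {suc m}))
    ≡⟨ cong (λ s → 1 + (1 + s)) (∑∑-adjacent m) ⟩
  1 + (1 + 2 * m)
    ≡⟨ arith m ⟩
  2 * suc m ∎
  where
  open ≡-Reasoning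
  to-zero : ∀ m → ∑[ y < suc m ] 𝟙 (toℕ y ≡ᵇ 0) ≡ 1
  to-zero m = cong suc (∑-zero m)
  arith : ∀ m → 1 + (1 + 2 * m) ≡ 2 * suc m
  arith = solve-∀

dist1-≢ : ∀ {m n} → dist1 m n ≡ true → (m ≡ᵇ n) ≡ true → ⊥
dist1-≢ {m} {n} d e with refl ← ≡ᵇ⇒≡ m n (subst T (sym e) _) = contradiction (trans (sym (dist1-irrefl m)) d) λ ()

module _ {a₁ a₂ a₃ : ℕ} where

  adj-sym : ∀ (v w : Vertex a₁ a₂ a₃) → adj v w ≡ adj w v
  adj-sym (x₁ , x₂ , x₃) (y₁ , y₂ , y₃)
    rewrite dist1-sym (toℕ x₁) (toℕ y₁) | dist1-sym (toℕ x₂) (toℕ y₂) | dist1-sym (toℕ x₃) (toℕ y₃)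
          | ≡ᵇ-sym (toℕ x₁) (toℕ y₁) | ≡ᵇ-sym (toℕ x₂) (toℕ y₂) | ≡ᵇ-sym (toℕ x₃) (toℕ y₃) = refl

  adj-irrefl : ∀ (v : Vertex a₁ a₂ a₃) → adj v v ≡ false
  adj-irrefl (x₁ , x₂ , x₃)
    rewrite dist1-irrefl (toℕ x₁) | dist1-irrefl (toℕ x₂) | dist1-irrefl (toℕ x₃)
          | ≡ᵇ-refl (toℕ x₁) | ≡ᵇ-refl (toℕ x₂) = refl

  edge₁ edge₂ edge₃ : Vertex a₁ a₂ a₃ → Vertex a₁ a₂ a₃ → ℕ
  edge₁ (x₁ , x₂ , x₃) (y₁ , y₂ , y₃) = adjacent x₁ y₁ * (equal x₂ y₂ * equal x₃ y₃)
  edge₂ (x₁ , x₂ , x₃) (y₁ , y₂ , y₃) = equal x₁ y₁ * (adjacent x₂ y₂ * equal x₃ y₃)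
  edge₃ (x₁ , x₂ , x₃) (y₁ , y₂ , y₃) = equal x₁ y₁ * (equal x₂ y₂ * adjacent x₃ y₃)

  𝟙-adj : ∀ v w → 𝟙 (adj v w) ≡ edge₁ v w + edge₂ v w + edge₃ v w
  𝟙-adj (x₁ , x₂ , x₃) (y₁ , y₂ , y₃) = begin
    𝟙 (P ∨ Q ∨ R)        ≡⟨ 𝟙-∨-disjoint P (Q ∨ R) P-excludes-Q∨R ⟩
    𝟙 P + 𝟙 (Q ∨ R)      ≡⟨ cong (𝟙 P +_) (𝟙-∨-disjoint Q R Q-excludes-R) ⟩
    𝟙 P + (𝟙 Q + 𝟙 R)    ≡⟨ +-assoc (𝟙 P) (𝟙 Q) (𝟙 R) ⟨
    𝟙 P + 𝟙 Q + 𝟙 R      ≡⟨ cong₂ _+_ (cong₂ _+_ (𝟙-∧³ d₁ e₂ e₃) (𝟙-∧³ e₁ d₂ e₃)) (𝟙-∧³ e₁ e₂ d₃) ⟩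
    edge₁ v w + edge₂ v w + edge₃ v w ∎
    where
    open ≡-Reasoning
    v = (x₁ , x₂ , x₃)
    w = (y₁ , y₂ , y₃)
    d₁ = dist1 (toℕ x₁) (toℕ y₁)
    d₂ = dist1 (toℕ x₂) (toℕ y₂)
    d₃ = dist1 (toℕ x₃) (toℕ y₃)
    e₁ = toℕ x₁ ≡ᵇ toℕ y₁
    e₂ = toℕ x₂ ≡ᵇ toℕ y₂
    e₃ = toℕ x₃ ≡ᵇ toℕ y₃
    P = d₁ ∧ e₂ ∧ e₃
    Q = e₁ ∧ d₂ ∧ e₃
    R = e₁ ∧ e₂ ∧ d₃
    P-excludes-Q∨R : P ≡ true → Q ∨ R ≡ true → ⊥
    P-excludes-Q∨R p q∨r = dist1-≢ {toℕ x₁} {toℕ y₁} (proj₁ (∧-true {d₁} {e₂ ∧ e₃} p)) (∧∨∧-true e₁ (d₂ ∧ e₃) (e₂ ∧ d₃) q∨r)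
    Q-excludes-R : Q ≡ true → R ≡ true → ⊥
    Q-excludes-R q r = dist1-≢ {toℕ x₂} {toℕ y₂} (proj₁ (∧-true {d₂} {e₃} (proj₂ (∧-true {e₁} {d₂ ∧ e₃} q))))
                                                 (proj₁ (∧-true {e₂} {d₃} (proj₂ (∧-true {e₁} {e₂ ∧ d₃} r))))

  ∑ᵥ∑ᵥ-separable : ∀ (f₁ : Fin a₁ → Fin a₁ → ℕ) (f₂ : Fin a₂ → Fin a₂ → ℕ) (f₃ : Fin a₃ → Fin a₃ → ℕ) →
    ∑ᵥ (λ v → ∑ᵥ (λ w → f₁ (proj₁ v) (proj₁ w) * (f₂ (proj₁ (proj₂ v)) (proj₁ (proj₂ w)) * f₃ (proj₂ (proj₂ v)) (proj₂ (proj₂ w)))))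
      ≡ ∑∑ f₁ * (∑∑ f₂ * ∑∑ f₃)
  ∑ᵥ∑ᵥ-separable f₁ f₂ f₃ =
    trans (sum-cong-≗ λ x₁ → sum-cong-≗ λ x₂ → sum-cong-≗ λ x₃ → ∑³-product (f₁ x₁) (f₂ x₂) (f₃ x₃))
          (∑³-product (λ x₁ → sum (f₁ x₁)) (λ x₂ → sum (f₂ x₂)) (λ x₃ → sum (f₃ x₃)))

-- The surface area of the infected set

module _ {a₁ a₂ a₃ : ℕ} where

  open import Data.List.Membership.DecPropositional (_≟ᵥ_ {a₁} {a₂} {a₃}) using (_∈?_)

  _≐_ : VSet a₁ a₂ a₃ → VSet a₁ a₂ a₃ → Set
  B ≐ C = ∀ v → B v ≡ C v

  _⊆_ : VSet a₁ a₂ a₃ → VSet a₁ a₂ a₃ → Set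
  B ⊆ C = ∀ v → B v ≡ true → C v ≡ true

  inducedDegreeSum : VSet a₁ a₂ a₃ → ℕ
  inducedDegreeSum B = ∑ᵥ (λ v → 𝟙 (B v) * degreeIn B v)

  count-cong : ∀ {B C} → B ≐ C → count B ≡ count C
  count-cong B≐C = ∑ᵥ-cong (cong 𝟙 ∘ B≐C)

  degreeIn-cong : ∀ {B C} → B ≐ C → ∀ v → degreeIn B v ≡ degreeIn C v
  degreeIn-cong B≐C v = ∑ᵥ-cong λ w → cong (λ b → 𝟙 (adj v w ∧ b)) (B≐C w)

  inducedDegreeSum-cong : ∀ {B C} → B ≐ C → inducedDegreeSum B ≡ inducedDegreeSum C
  inducedDegreeSum-cong B≐C = ∑ᵥ-cong λ v → cong₂ _*_ (cong 𝟙 (B≐C v)) (degreeIn-cong B≐C v)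

  degreeIn-mono : ∀ {B C} → B ⊆ C → ∀ v → degreeIn B v ≤ degreeIn C v
  degreeIn-mono B⊆C v = ∑ᵥ-mono-≤ λ w → 𝟙-∧-mono (adj v w) (B⊆C w)

  insert : Vertex a₁ a₂ a₃ → VSet a₁ a₂ a₃ → VSet a₁ a₂ a₃
  insert x B w = B w ∨ does (w ≟ᵥ x)

  insert-present : ∀ {B x} → B x ≡ true → insert x B ≐ B
  insert-present {B} {x} x∈B w = present (w ≟ᵥ x)
    where
    present : (d : Dec (w ≡ x)) → B w ∨ does d ≡ B w
    present (yes refl) rewrite x∈B = refl
    present (no _)     = ∨-identityʳ (B w)

  𝟙-insert : ∀ {B x} → B x ≡ false → ∀ w → 𝟙 (insert x B w) ≡ 𝟙 (B w) + δᵥ w x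
  𝟙-insert {B} {x} x∉B w = split (w ≟ᵥ x)
    where
    split : (d : Dec (w ≡ x)) → 𝟙 (B w ∨ does d) ≡ 𝟙 (B w) + 𝟙 (does d)
    split (yes refl) rewrite x∉B = refl
    split (no _)     = trans (cong 𝟙 (∨-identityʳ (B w))) (sym (+-identityʳ _))

  count-insert : ∀ {B x} → B x ≡ false → count (insert x B) ≡ count B + 1
  count-insert {B} {x} x∉B =
    trans (∑ᵥ-cong (𝟙-insert x∉B)) (trans (∑ᵥ-distrib-+ (𝟙 ∘ B) (λ w → δᵥ w x)) (cong (count B +_) (∑ᵥ-δᵥ x)))

  degreeIn-insert : ∀ {B x} → B x ≡ false → ∀ v → degreeIn (insert x B) v ≡ degreeIn B v + 𝟙 (adj v x)
  degreeIn-insert {B} {x} x∉B v = begin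
    degreeIn (insert x B) v
      ≡⟨ ∑ᵥ-cong split ⟩
    ∑ᵥ (λ w → 𝟙 (adj v w ∧ B w) + δᵥ w x * 𝟙 (adj v w))
      ≡⟨ ∑ᵥ-distrib-+ (λ w → 𝟙 (adj v w ∧ B w)) (λ w → δᵥ w x * 𝟙 (adj v w)) ⟩
    degreeIn B v + ∑ᵥ (λ w → δᵥ w x * 𝟙 (adj v w))
      ≡⟨ cong (degreeIn B v +_) (∑ᵥ-select (λ w → 𝟙 (adj v w)) x) ⟩
    degreeIn B v + 𝟙 (adj v x) ∎
    where
    open ≡-Reasoning
    split : ∀ w → 𝟙 (adj v w ∧ insert x B w) ≡ 𝟙 (adj v w ∧ B w) + δᵥ w x * 𝟙 (adj v w)
    split w = begin
      𝟙 (adj v w ∧ insert x B w)             ≡⟨ 𝟙-∧ (adj v w) (insert x B w) ⟩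
      𝟙 (adj v w) * 𝟙 (insert x B w)         ≡⟨ cong (𝟙 (adj v w) *_) (𝟙-insert x∉B w) ⟩
      𝟙 (adj v w) * (𝟙 (B w) + δᵥ w x)       ≡⟨ *-distribˡ-+ (𝟙 (adj v w)) (𝟙 (B w)) (δᵥ w x) ⟩
      𝟙 (adj v w) * 𝟙 (B w) + 𝟙 (adj v w) * δᵥ w x
                                              ≡⟨ cong₂ _+_ (sym (𝟙-∧ (adj v w) (B w))) (*-comm (𝟙 (adj v w)) (δᵥ w x)) ⟩
      𝟙 (adj v w ∧ B w) + δᵥ w x * 𝟙 (adj v w) ∎

  inducedDegreeSum-insert : ∀ {B x} → B x ≡ false →
                            inducedDegreeSum (insert x B) ≡ inducedDegreeSum B + 2 * degreeIn B x
  inducedDegreeSum-insert {B} {x} x∉B = begin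
    inducedDegreeSum (insert x B)
      ≡⟨ ∑ᵥ-cong expand ⟩
    ∑ᵥ (λ w → p w + q w + r w + u w)
      ≡⟨ ∑ᵥ-distrib-+ (λ w → p w + q w + r w) u ⟩
    ∑ᵥ (λ w → p w + q w + r w) + ∑ᵥ u
      ≡⟨ cong (_+ ∑ᵥ u) (trans (∑ᵥ-distrib-+ (λ w → p w + q w) r) (cong (_+ ∑ᵥ r) (∑ᵥ-distrib-+ p q))) ⟩
    inducedDegreeSum B + ∑ᵥ q + ∑ᵥ r + ∑ᵥ u
      ≡⟨ cong₂ _+_ (cong₂ _+_ (cong (inducedDegreeSum B +_) sum-q) (∑ᵥ-select (degreeIn B) x))
                   (trans (∑ᵥ-select (λ w → 𝟙 (adj w x)) x) (cong 𝟙 (adj-irrefl x))) ⟩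
    inducedDegreeSum B + degreeIn B x + degreeIn B x + 0
      ≡⟨ collect (inducedDegreeSum B) (degreeIn B x) ⟩
    inducedDegreeSum B + 2 * degreeIn B x ∎
    where
    open ≡-Reasoning
    p q r u : Vertex a₁ a₂ a₃ → ℕ
    p w = 𝟙 (B w) * degreeIn B w
    q w = 𝟙 (B w) * 𝟙 (adj w x)
    r w = δᵥ w x * degreeIn B w
    u w = δᵥ w x * 𝟙 (adj w x)
    distribute : ∀ b e d k → (b + e) * (d + k) ≡ b * d + b * k + e * d + e * k
    distribute = solve-∀
    expand : ∀ w → 𝟙 (insert x B w) * degreeIn (insert x B) w ≡ p w + q w + r w + u w
    expand w = trans (cong₂ _*_ (𝟙-insert {B} {x} x∉B w) (degreeIn-insert {B} {x} x∉B w))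
                     (distribute (𝟙 (B w)) (δᵥ w x) (degreeIn B w) (𝟙 (adj w x)))
    sum-q : ∑ᵥ q ≡ degreeIn B x
    sum-q = ∑ᵥ-cong λ w → trans (*-comm (𝟙 (B w)) (𝟙 (adj w x)))
                               (trans (cong (λ b → 𝟙 b * 𝟙 (B w)) (adj-sym w x)) (sym (𝟙-∧ (adj x w) (B w))))
    collect : ∀ s d → s + d + d + 0 ≡ s + 2 * d
    collect = solve-∀

  -- The potential 6|X| − Σ_{x∈X} deg_X x (the exposed faces of the cubes of X), compared without subtraction.
  PotentialDecrease : VSet a₁ a₂ a₃ → VSet a₁ a₂ a₃ → Set
  PotentialDecrease B C = 6 * count C + inducedDegreeSum B ≤ 6 * count B + inducedDegreeSum C

  potential-refl : ∀ B → PotentialDecrease B B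
  potential-refl B = ≤-refl

  potential-trans : ∀ {B C D} → PotentialDecrease B C → PotentialDecrease C D → PotentialDecrease B D
  potential-trans {B} {C} {D} B↘C C↘D =
    +-cancelʳ-≤ (y + q) (z + p) (x + r) (subst₂ _≤_ (swap₁ y z p q) (swap₂ x y q r) (+-mono-≤ B↘C C↘D))
    where
    x = 6 * count B
    y = 6 * count C
    z = 6 * count D
    p = inducedDegreeSum B
    q = inducedDegreeSum C
    r = inducedDegreeSum D
    swap₁ : ∀ y z p q → y + p + (z + q) ≡ z + p + (y + q)
    swap₁ = solve-∀
    swap₂ : ∀ x y q r → x + q + (y + r) ≡ x + r + (y + q)
    swap₂ = solve-∀

  potential-respʳ : ∀ {B C D} → C ≐ D → PotentialDecrease B C → PotentialDecrease B D
  potential-respʳ {B} C≐D = subst₂ (λ c s → 6 * c + inducedDegreeSum B ≤ 6 * count B + s)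
                                  (count-cong C≐D) (inducedDegreeSum-cong C≐D)

  potential-insert : ∀ {B C x} → PotentialDecrease B C → B ⊆ C → 3 ≤ degreeIn B x → C x ≡ false →
                     PotentialDecrease B (insert x C)
  potential-insert {B} {C} {x} B↘C B⊆C x-rich x∉C
    rewrite count-insert {C} {x} x∉C | inducedDegreeSum-insert {C} {x} x∉C =
    subst₂ _≤_ (lhs (count C) (inducedDegreeSum B)) (rhs (count B) (inducedDegreeSum C) (degreeIn C x))
      (+-mono-≤ B↘C (*-monoʳ-≤ 2 (≤-trans x-rich (degreeIn-mono B⊆C x))))
    where
    lhs : ∀ c s → 6 * c + s + 2 * 3 ≡ 6 * (c + 1) + s
    lhs = solve-∀
    rhs : ∀ b s d → 6 * b + s + 2 * d ≡ 6 * b + (s + 2 * d)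
    rhs = solve-∀

  extend : VSet a₁ a₂ a₃ → List (Vertex a₁ a₂ a₃) → VSet a₁ a₂ a₃
  extend B L w = B w ∨ (does (w ∈? L) ∧ three≤ (degreeIn B w))

  ⊆-extend : ∀ B L → B ⊆ extend B L
  ⊆-extend B L v Bv rewrite Bv = refl

  extend-∷ : ∀ B x L w → extend B (x ∷ L) w ≡ (if three≤ (degreeIn B x) then insert x (extend B L) w else extend B L w)
  extend-∷ B x L w = split (w ≟ᵥ x)
    where
    C = extend B L
    split : (d : Dec (w ≡ x)) → B w ∨ ((does d ∨ does (w ∈? L)) ∧ three≤ (degreeIn B w))
                                ≡ (if three≤ (degreeIn B x) then C w ∨ does d else C w)
    split (yes refl) with three≤ (degreeIn B w)
    ... | true  = trans (∨-zeroʳ (B w)) (sym (∨-zeroʳ _))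
    ... | false = cong (B w ∨_) (sym (∧-zeroʳ (does (w ∈? L))))
    split (no _) with three≤ (degreeIn B x)
    ... | true  = sym (∨-identityʳ _)
    ... | false = refl

  extend-∷-poor : ∀ B x L → three≤ (degreeIn B x) ≡ false → extend B (x ∷ L) ≐ extend B L
  extend-∷-poor B x L poor w =
    trans (extend-∷ B x L w) (cong (λ b → if b then insert x (extend B L) w else extend B L w) poor)

  extend-∷-rich : ∀ B x L → three≤ (degreeIn B x) ≡ true → extend B (x ∷ L) ≐ insert x (extend B L)
  extend-∷-rich B x L rich w =
    trans (extend-∷ B x L w) (cong (λ b → if b then insert x (extend B L) w else extend B L w) rich)

  potential-extend : ∀ B L → PotentialDecrease B (extend B L)
  potential-extend B []      = potential-respʳ (λ w → sym (∨-identityʳ (B w))) (potential-refl B)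
  potential-extend B (x ∷ L) = by-cases (three≤ (degreeIn B x)) (extend B L x) refl refl
    where
    IH = potential-extend B L
    by-cases : ∀ r c → three≤ (degreeIn B x) ≡ r → extend B L x ≡ c → PotentialDecrease B (extend B (x ∷ L))
    by-cases false _     poor _   = potential-respʳ (sym ∘ extend-∷-poor B x L poor) IH
    by-cases true  true  rich x∈C =
      potential-respʳ (λ w → sym (trans (extend-∷-rich B x L rich w) (insert-present {extend B L} {x} x∈C w))) IH
    by-cases true  false rich x∉C =
      potential-respʳ (sym ∘ extend-∷-rich B x L rich) (potential-insert IH (⊆-extend B L) (three≤-sound rich) x∉C)

  ∈-vertices : ∀ v → v ∈ vertices a₁ a₂ a₃
  ∈-vertices (i , j , k) =
    ∈-concatMap⁺ _ (lose (∈-allFin i) (∈-concatMap⁺ _ (lose (∈-allFin j) (∈-map⁺ (λ k → i , j , k) (∈-allFin k)))))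

  extend-vertices : ∀ B → extend B (vertices a₁ a₂ a₃) ≐ step B
  extend-vertices B w rewrite dec-true (w ∈? vertices a₁ a₂ a₃) (∈-vertices w) | nbrsIn≡degreeIn B w = refl

  potential-iter : ∀ A t → PotentialDecrease A (iter t A)
  potential-iter A zero    = potential-refl A
  potential-iter A (suc t) =
    potential-trans (potential-iter A t)
                    (potential-respʳ (extend-vertices (iter t A)) (potential-extend (iter t A) (vertices a₁ a₂ a₃)))

module _ {a₁ a₂ a₃ : ℕ} where

  full : VSet a₁ a₂ a₃
  full _ = true

  count-full : count full ≡ a₁ * (a₂ * a₃)
  count-full = begin
    ∑[ i < a₁ ] ∑[ j < a₂ ] ∑[ k < a₃ ] 1  ≡⟨ cong (λ c → ∑[ i < a₁ ] ∑[ j < a₂ ] c) (trans (∑-const a₃ 1) (*-identityʳ a₃)) ⟩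
    ∑[ i < a₁ ] ∑[ j < a₂ ] a₃            ≡⟨ cong (λ c → ∑[ i < a₁ ] c) (∑-const a₂ a₃) ⟩
    ∑[ i < a₁ ] (a₂ * a₃)                 ≡⟨ ∑-const a₁ (a₂ * a₃) ⟩
    a₁ * (a₂ * a₃)                        ∎
    where open ≡-Reasoning

  inducedDegreeSum-full : inducedDegreeSum full ≡
    ∑∑ (adjacent {a₁}) * (a₂ * a₃) + a₁ * (∑∑ (adjacent {a₂}) * a₃) + a₁ * (a₂ * ∑∑ (adjacent {a₃}))
  inducedDegreeSum-full = begin
    inducedDegreeSum full
      ≡⟨ ∑ᵥ-cong degree-by-axes ⟩
    ∑ᵥ (λ v → degree₁ v + degree₂ v + degree₃ v)
      ≡⟨ trans (∑ᵥ-distrib-+ (λ v → degree₁ v + degree₂ v) degree₃) (cong (_+ ∑ᵥ degree₃) (∑ᵥ-distrib-+ degree₁ degree₂)) ⟩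
    ∑ᵥ degree₁ + ∑ᵥ degree₂ + ∑ᵥ degree₃
      ≡⟨ cong₂ _+_ (cong₂ _+_ (∑ᵥ∑ᵥ-separable {a₁} {a₂} {a₃} adjacent equal equal)
                              (∑ᵥ∑ᵥ-separable {a₁} {a₂} {a₃} equal adjacent equal))
                   (∑ᵥ∑ᵥ-separable {a₁} {a₂} {a₃} equal equal adjacent) ⟩
    ∑∑ (adjacent {a₁}) * (∑∑ (equal {a₂}) * ∑∑ (equal {a₃})) + ∑∑ (equal {a₁}) * (∑∑ (adjacent {a₂}) * ∑∑ (equal {a₃}))
      + ∑∑ (equal {a₁}) * (∑∑ (equal {a₂}) * ∑∑ (adjacent {a₃}))
      ≡⟨ cong₂ _+_ (cong₂ _+_ (cong (∑∑ (adjacent {a₁}) *_) (cong₂ _*_ (∑∑-equal a₂) (∑∑-equal a₃)))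
                              (cong₂ _*_ (∑∑-equal a₁) (cong (∑∑ (adjacent {a₂}) *_) (∑∑-equal a₃))))
                   (cong₂ _*_ (∑∑-equal a₁) (cong (_* ∑∑ (adjacent {a₃})) (∑∑-equal a₂))) ⟩
    ∑∑ (adjacent {a₁}) * (a₂ * a₃) + a₁ * (∑∑ (adjacent {a₂}) * a₃) + a₁ * (a₂ * ∑∑ (adjacent {a₃})) ∎
    where
    open ≡-Reasoning
    degree₁ degree₂ degree₃ : Vertex a₁ a₂ a₃ → ℕ
    degree₁ v = ∑ᵥ (edge₁ v)
    degree₂ v = ∑ᵥ (edge₂ v)
    degree₃ v = ∑ᵥ (edge₃ v)
    degree-by-axes : ∀ v → 𝟙 (full v) * degreeIn full v ≡ degree₁ v + degree₂ v + degree₃ v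
    degree-by-axes v = begin
      degreeIn full v + 0
        ≡⟨ +-identityʳ (degreeIn full v) ⟩
      ∑ᵥ (λ w → 𝟙 (adj v w ∧ true))
        ≡⟨ ∑ᵥ-cong (λ w → trans (cong 𝟙 (∧-identityʳ (adj v w))) (𝟙-adj v w)) ⟩
      ∑ᵥ (λ w → edge₁ v w + edge₂ v w + edge₃ v w)
        ≡⟨ ∑ᵥ-distrib-+ (λ w → edge₁ v w + edge₂ v w) (edge₃ v) ⟩
      ∑ᵥ (λ w → edge₁ v w + edge₂ v w) + ∑ᵥ (edge₃ v)
        ≡⟨ cong (_+ ∑ᵥ (edge₃ v)) (∑ᵥ-distrib-+ (edge₁ v) (edge₂ v)) ⟩
      ∑ᵥ (edge₁ v) + ∑ᵥ (edge₂ v) + ∑ᵥ (edge₃ v) ∎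

full-surface-area : ∀ {m₁ m₂ m₃} →
  2 * (suc m₁ * suc m₂ + suc m₁ * suc m₃ + suc m₂ * suc m₃) + inducedDegreeSum (full {suc m₁} {suc m₂} {suc m₃})
    ≡ 6 * count (full {suc m₁} {suc m₂} {suc m₃})
full-surface-area {m₁} {m₂} {m₃} = begin
  2 * surface + inducedDegreeSum F
    ≡⟨ cong (2 * surface +_) (inducedDegreeSum-full {suc m₁} {suc m₂} {suc m₃}) ⟩
  2 * surface + (∑∑ (adjacent {suc m₁}) * (suc m₂ * suc m₃) + suc m₁ * (∑∑ (adjacent {suc m₂}) * suc m₃)
                 + suc m₁ * (suc m₂ * ∑∑ (adjacent {suc m₃})))
    ≡⟨ cong (2 * surface +_) (cong₂ _+_ (cong₂ _+_ (cong (_* (suc m₂ * suc m₃)) (∑∑-adjacent m₁))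
                                                   (cong (λ d → suc m₁ * (d * suc m₃)) (∑∑-adjacent m₂)))
                                        (cong (λ d → suc m₁ * (suc m₂ * d)) (∑∑-adjacent m₃))) ⟩
  2 * surface + (2 * m₁ * (suc m₂ * suc m₃) + suc m₁ * (2 * m₂ * suc m₃) + suc m₁ * (suc m₂ * (2 * m₃)))
    ≡⟨ faces m₁ m₂ m₃ ⟩
  6 * (suc m₁ * (suc m₂ * suc m₃))
    ≡⟨ cong (6 *_) (count-full {suc m₁} {suc m₂} {suc m₃}) ⟨
  6 * count F ∎
  where
  open ≡-Reasoning
  F : VSet (suc m₁) (suc m₂) (suc m₃)
  F = full
  surface = suc m₁ * suc m₂ + suc m₁ * suc m₃ + suc m₂ * suc m₃
  faces : ∀ m₁ m₂ m₃ →
    2 * (suc m₁ * suc m₂ + suc m₁ * suc m₃ + suc m₂ * suc m₃)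
      + (2 * m₁ * (suc m₂ * suc m₃) + suc m₁ * (2 * m₂ * suc m₃) + suc m₁ * (suc m₂ * (2 * m₃)))
    ≡ 6 * (suc m₁ * (suc m₂ * suc m₃))
  faces = solve-∀

percolating-set-lower-bound : ∀ {m₁ m₂ m₃} (A : VSet (suc m₁) (suc m₂) (suc m₃)) → Percolates A →
  suc m₁ * suc m₂ + suc m₁ * suc m₃ + suc m₂ * suc m₃ ≤ 3 * size A
percolating-set-lower-bound {m₁} {m₂} {m₃} A percolates =
  *-cancelˡ-≤ 2 (+-cancelʳ-≤ (inducedDegreeSum F) (2 * surface) (2 * (3 * size A)) (begin
    2 * surface + inducedDegreeSum F     ≡⟨ full-surface-area {m₁} {m₂} {m₃} ⟩
    6 * count F                          ≤⟨ m≤m+n (6 * count F) (inducedDegreeSum A) ⟩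
    6 * count F + inducedDegreeSum A     ≤⟨ potential-respʳ {B = A} {C = iter t A} {D = F} eventually-full (potential-iter A t) ⟩
    6 * count A + inducedDegreeSum F     ≡⟨ cong (_+ inducedDegreeSum F) (trans (cong (6 *_) (sym (size≡count A))) (*-assoc 2 3 (size A))) ⟩
    2 * (3 * size A) + inducedDegreeSum F ∎))
  where
  open ≤-Reasoning
  F : VSet (suc m₁) (suc m₂) (suc m₃)
  F = full
  surface = suc m₁ * suc m₂ + suc m₁ * suc m₃ + suc m₂ * suc m₃
  t = ∑ᵥ (λ v → proj₁ (percolates v))
  eventually-full : iter t A ≐ F
  eventually-full v = iter-mono A v (∑ᵥ-≥ (λ v → proj₁ (percolates v)) v) (proj₂ (percolates v))

-- Infection certificates

Cell : Set
Cell = ℕ × ℕ × ℕ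

Pattern : Set
Pattern = List (ℕ × ℕ)

_≟ᶜ_ : DecidableEquality Cell
_≟ᶜ_ = ≡-dec ℕ._≟_ (≡-dec ℕ._≟_ ℕ._≟_)

-- The adjacency of Defs on coordinates: adj v w reduces to adjℕ (coords v) (coords w).
adjℕ : Cell → Cell → Bool
adjℕ (x₁ , x₂ , x₃) (y₁ , y₂ , y₃) =
     (dist1 x₁ y₁ ∧ (x₂ ≡ᵇ y₂) ∧ (x₃ ≡ᵇ y₃))
  ∨ ((x₁ ≡ᵇ y₁) ∧ dist1 x₂ y₂ ∧ (x₃ ≡ᵇ y₃))
  ∨ ((x₁ ≡ᵇ y₁) ∧ (x₂ ≡ᵇ y₂) ∧ dist1 x₃ y₃)

translate : ℕ → Cell → Cell
translate s (i , j , c) = i , j , c + s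

≡ᵇ-+ʳ : ∀ s m n → (m + s ≡ᵇ n + s) ≡ (m ≡ᵇ n)
≡ᵇ-+ʳ s m n = does-⇔ (mk⇔ (+-cancelʳ-≡ s m n) (cong (_+ s))) (m + s ℕ.≟ n + s) (m ℕ.≟ n)

adjℕ-translate : ∀ s x y → adjℕ (translate s x) (translate s y) ≡ adjℕ x y
adjℕ-translate s (i , j , c) (i′ , j′ , c′)
  rewrite ≡ᵇ-+ʳ s c c′ | ≡ᵇ-+ʳ s c (suc c′) | ≡ᵇ-+ʳ s c′ (suc c) = refl

translate-injective : ∀ s {x y} → translate s x ≡ translate s y → x ≡ y
translate-injective s {i , j , c} {i′ , j′ , c′} eq
  with refl ← cong proj₁ eq | refl ← cong (proj₁ ∘ proj₂) eq
  rewrite +-cancelʳ-≡ s c c′ (cong (proj₂ ∘ proj₂) eq) = refl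

layer : ℕ → Pattern → List Cell
layer c = map (λ p → proj₁ p , proj₂ p , c)

stackFrom : ℕ → List Pattern → List Cell
stackFrom c []       = []
stackFrom c (P ∷ Ps) = layer c P ++ stackFrom (suc c) Ps

stack : List Pattern → List Cell
stack = stackFrom 0

record Step : Set where
  constructor _⇐_
  field
    target  : Cell
    sources : Cell × Cell × Cell

infix 3 _⇐_

derived : List Cell → List Step → List Cell
derived K []                = K
derived K ((v ⇐ _) ∷ steps) = derived (v ∷ K) steps

module _ {m₁ m₂ : ℕ} where

  open import Data.List.Membership.DecPropositional _≟ᶜ_ using (_∈?_)

  InWindow : ℕ → Cell → Set
  InWindow W (i , j , c) = i ≤ m₁ × j ≤ m₂ × c < W

  ValidStep : ℕ → List Cell → Step → Set
  ValidStep W K (v ⇐ (x , y , z)) =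
    All (InWindow W) (v ∷ x ∷ y ∷ z ∷ []) × All (_∈ K) (x ∷ y ∷ z ∷ []) ×
    All (λ u → adjℕ v u ≡ true) (x ∷ y ∷ z ∷ []) × x ≢ y × x ≢ z × y ≢ z

  ValidDerivation : ℕ → List Cell → List Step → Set
  ValidDerivation W K []           = ⊤
  ValidDerivation W K (st ∷ steps) = ValidStep W K st × ValidDerivation W (Step.target st ∷ K) steps

  validStep? : ∀ W K st → Dec (ValidStep W K st)
  validStep? W K (v ⇐ (x , y , z)) =
    all? inWindow? _ ×-dec all? (_∈? K) _ ×-dec all? (λ u → adjℕ v u ≟B true) _ ×-dec
    ¬? (x ≟ᶜ y) ×-dec ¬? (x ≟ᶜ z) ×-dec ¬? (y ≟ᶜ z)
    where
    inWindow? : ∀ c → Dec (InWindow W c)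
    inWindow? (i , j , c) = i ℕ.≤? m₁ ×-dec j ℕ.≤? m₂ ×-dec c ℕ.<? W

  validDerivation? : ∀ W K steps → Dec (ValidDerivation W K steps)
  validDerivation? W K []           = yes tt
  validDerivation? W K (st ∷ steps) = validStep? W K st ×-dec validDerivation? W (Step.target st ∷ K) steps

  -- Ks and Gs list the patterns of consecutive layers of the window, bottom layer first.
  record Certificate (W : ℕ) (Ks Gs : List Pattern) : Set where
    field
      steps  : List Step
      valid  : ValidDerivation W (stack Ks) steps
      covers : All (_∈ derived (stack Ks) steps) (stack Gs)

  certify : ∀ W Ks Gs steps → True (validDerivation? W (stack Ks) steps) →
            True (all? (_∈? derived (stack Ks) steps) (stack Gs)) → Certificate W Ks Gs
  certify W Ks Gs steps valid covers = record { steps = steps ; valid = toWitness valid ; covers = toWitness covers }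

-- Saturates at m; it is only applied to arguments ≤ m.
clamp : ∀ {m} → ℕ → Fin (suc m)
clamp {m} k = fromℕ< (s≤s (m⊓n≤n k m))

toℕ-clamp : ∀ {m k} → k ≤ m → toℕ (clamp {m} k) ≡ k
toℕ-clamp {m} {k} k≤m = trans (Fin.toℕ-fromℕ< (s≤s (m⊓n≤n k m))) (m≤n⇒m⊓n≡m k≤m)

clamp-toℕ : ∀ {m} (i : Fin (suc m)) → clamp (toℕ i) ≡ i
clamp-toℕ i = Fin.toℕ-injective (toℕ-clamp (s≤s⁻¹ (Fin.toℕ<n i)))

coords : ∀ {a₁ a₂ a₃} → Vertex a₁ a₂ a₃ → Cell
coords (x₁ , x₂ , x₃) = toℕ x₁ , toℕ x₂ , toℕ x₃

module _ {m₁ m₂ n : ℕ} where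

  place : ℕ → Cell → Vertex (suc m₁) (suc m₂) (suc n)
  place s (i , j , c) = clamp i , clamp j , clamp (c + s)

  coords-place : ∀ {W s x} → W + s ≤ suc n → InWindow {m₁} {m₂} W x → coords (place s x) ≡ translate s x
  coords-place {W} {s} {i , j , c} fits (i≤m₁ , j≤m₂ , c<W) =
    cong₂ _,_ (toℕ-clamp i≤m₁) (cong₂ _,_ (toℕ-clamp j≤m₂) (toℕ-clamp (s≤s⁻¹ (≤-trans (+-monoˡ-≤ s c<W) fits))))

  adj-place : ∀ {W s x y} → W + s ≤ suc n → InWindow {m₁} {m₂} W x → InWindow {m₁} {m₂} W y →
              adj (place s x) (place s y) ≡ adjℕ x y
  adj-place {s = s} {x} {y} fits x∈W y∈W =
    trans (cong₂ adjℕ (coords-place fits x∈W) (coords-place fits y∈W)) (adjℕ-translate s x y)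

  place-injective : ∀ {W s x y} → W + s ≤ suc n → InWindow {m₁} {m₂} W x → InWindow {m₁} {m₂} W y →
                    place s x ≡ place s y → x ≡ y
  place-injective {s = s} fits x∈W y∈W eq =
    translate-injective s (trans (sym (coords-place fits x∈W)) (trans (cong coords eq) (coords-place fits y∈W)))

module _ {m₁ m₂ n : ℕ} (A : VSet (suc m₁) (suc m₂) (suc n)) where

  InfectedLayer : ℕ → Pattern → Set
  InfectedLayer k = All (λ p → Infected A (clamp (proj₁ p) , clamp (proj₂ p) , clamp k))

  InfectedStack : ℕ → List Pattern → Set
  InfectedStack k []       = ⊤
  InfectedStack k (P ∷ Ps) = InfectedLayer k P × InfectedStack (suc k) Ps

  step-sound : ∀ {W s K} st → W + s ≤ suc n → ValidStep {m₁} {m₂} W K st →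
               All (Infected A ∘ place s) K → Infected A (place s (Step.target st))
  step-sound {s = s} (v ⇐ (x , y , z)) fits
             (v∈W ∷ x∈W ∷ y∈W ∷ z∈W ∷ [] , x∈K ∷ y∈K ∷ z∈K ∷ [] , v~x ∷ v~y ∷ v~z ∷ [] , x≢y , x≢z , y≢z) infected =
    infected-by-three A (place s v)
      (x≢y ∘ place-injective fits x∈W y∈W) (x≢z ∘ place-injective fits x∈W z∈W) (y≢z ∘ place-injective fits y∈W z∈W)
      (trans (adj-place fits v∈W x∈W) v~x) (trans (adj-place fits v∈W y∈W) v~y) (trans (adj-place fits v∈W z∈W) v~z)
      (All.lookup infected x∈K) (All.lookup infected y∈K) (All.lookup infected z∈K)

  derivation-sound : ∀ {W s} K steps → W + s ≤ suc n → ValidDerivation {m₁} {m₂} W K steps →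
                     All (Infected A ∘ place s) K → All (Infected A ∘ place s) (derived K steps)
  derivation-sound K []           fits _                infected = infected
  derivation-sound K (st ∷ steps) fits (valid , valids) infected =
    derivation-sound (Step.target st ∷ K) steps fits valids (step-sound st fits valid infected ∷ infected)

  stack⁺ : ∀ {s} c Ps → InfectedStack (c + s) Ps → All (Infected A ∘ place s) (stackFrom c Ps)
  stack⁺ c []       _        = []
  stack⁺ c (P ∷ Ps) (l , ls) = All.++⁺ (All.map⁺ l) (stack⁺ (suc c) Ps ls)

  stack⁻ : ∀ {s} c Ps → All (Infected A ∘ place s) (stackFrom c Ps) → InfectedStack (c + s) Ps
  stack⁻ c []       _        = tt
  stack⁻ c (P ∷ Ps) infected =
    All.map⁻ (All.++⁻ˡ (layer c P) infected) , stack⁻ (suc c) Ps (All.++⁻ʳ (layer c P) infected)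

  certificate-sound : ∀ {W s Ks Gs} → Certificate {m₁} {m₂} W Ks Gs → W + s ≤ suc n →
                      InfectedStack s Ks → InfectedStack s Gs
  certificate-sound {Ks = Ks} {Gs} cert fits infected =
    stack⁻ 0 Gs (All.map (All.lookup (derivation-sound (stack Ks) steps fits valid (stack⁺ 0 Ks infected))) covers)
    where open Certificate cert

-- A percolating set of size 17 + 10r in [2] × [3] × [9 + 6r]

≤-extend : ∀ {Q : ℕ → Set} {m} → (∀ k → k ≤ m → Q k) → Q (suc m) → ∀ k → k ≤ suc m → Q k
≤-extend below top k k≤1+m with m≤n⇒m<n∨m≡n k≤1+m
... | inj₁ k<1+m = below k (s≤s⁻¹ k<1+m)
... | inj₂ refl  = top

≤-zero : ∀ {Q : ℕ → Set} → Q 0 → ∀ k → k ≤ 0 → Q k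
≤-zero q₀ zero z≤n = q₀

corner allButCorner wholeLayer row₁ bottom : Pattern
corner       = (0 , 2) ∷ []
allButCorner = (0 , 0) ∷ (0 , 1) ∷ (1 , 0) ∷ (1 , 1) ∷ (1 , 2) ∷ []
wholeLayer   = allButCorner ++ corner
row₁         = (1 , 0) ∷ (1 , 1) ∷ (1 , 2) ∷ []
bottom       = (0 , 1) ∷ (1 , 0) ∷ (1 , 2) ∷ []

top : ℕ → Pattern
top 0 = corner
top 1 = bottom
top _ = []

-- upper r k is the pattern of layer k + 1 of the initial set in [2] × [3] × [9 + 6r]: a block of six
-- layers repeated r + 1 times, followed by the two top layers.
upper : ℕ → ℕ → Pattern
upper r       0 = (0 , 0) ∷ []
upper r       1 = (0 , 1) ∷ (1 , 2) ∷ []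
upper r       2 = (0 , 0) ∷ (1 , 1) ∷ []
upper r       3 = (1 , 2) ∷ []
upper r       4 = (0 , 0) ∷ (1 , 1) ∷ []
upper r       5 = (1 , 0) ∷ (1 , 2) ∷ []
upper zero    (suc (suc (suc (suc (suc (suc k)))))) = top k
upper (suc r) (suc (suc (suc (suc (suc (suc k)))))) = upper r k

initialPattern : ℕ → ℕ → Pattern
initialPattern r zero    = bottom
initialPattern r (suc k) = upper r k

upper-periodic : ∀ b r k → upper (b + r) (k + b * 6) ≡ upper r k
upper-periodic zero    r k = cong (upper r) (+-identityʳ k)
upper-periodic (suc b) r k = trans (cong (upper (suc (b + r))) (regroup k (b * 6))) (upper-periodic b r k)
  where
  regroup : ∀ k x → k + (6 + x) ≡ 6 + (k + x)
  regroup = solve-∀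

-- Clamping the coordinates spares a range check on the patterns.
positions : Pattern → List (Fin 2 × Fin 3)
positions = map (λ p → clamp (proj₁ p) , clamp (proj₂ p))

open import Data.List.Membership.DecPropositional (≡-dec (Fin._≟_ {2}) (Fin._≟_ {3})) using () renaming (_∈?_ to _∈ₚ?_)

initialSet : ∀ r → VSet 2 3 (9 + r * 6)
initialSet r (x₁ , x₂ , x₃) = does ((x₁ , x₂) ∈ₚ? positions (initialPattern r (toℕ x₃)))

layerSize : Pattern → ℕ
layerSize P = ∑[ i < 2 ] ∑[ j < 3 ] 𝟙 (does ((i , j) ∈ₚ? positions P))

upper-size : ∀ r → ∑[ k < 8 + r * 6 ] layerSize (upper r (toℕ k)) ≡ 14 + r * 10
upper-size zero    = refl
upper-size (suc r) = cong (10 +_) (upper-size r)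

count-initialSet : ∀ r → count (initialSet r) ≡ 17 + r * 10
count-initialSet r = begin
  ∑[ i < 2 ] ∑[ j < 3 ] ∑[ k < a ] g i j k   ≡⟨ sum-cong-≗ (λ i → ∑-comm (g i)) ⟩
  ∑[ i < 2 ] ∑[ k < a ] ∑[ j < 3 ] g i j k   ≡⟨ ∑-comm (λ i k → ∑[ j < 3 ] g i j k) ⟩
  ∑[ k < a ] layerSize (initialPattern r (toℕ k)) ≡⟨ cong (3 +_) (upper-size r) ⟩
  17 + r * 10                                ∎
  where
  open ≡-Reasoning
  a = 9 + r * 6
  g : Fin 2 → Fin 3 → Fin a → ℕ
  g i j k = 𝟙 (initialSet r (i , j , k))

baseCertificate : Certificate {1} {2} 7
  (bottom ∷ upper 0 0 ∷ upper 0 1 ∷ upper 0 2 ∷ upper 0 3 ∷ upper 0 4 ∷ upper 0 5 ∷ [])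
  (allButCorner ∷ allButCorner ∷ allButCorner ∷ allButCorner ∷ allButCorner ∷ allButCorner ∷ row₁ ∷ [])
baseCertificate = certify _ _ _
  ( ((0 , 0 , 0) ⇐ (1 , 0 , 0) , (0 , 1 , 0) , (0 , 0 , 1))
    ∷ ((1 , 1 , 0) ⇐ (0 , 1 , 0) , (1 , 0 , 0) , (1 , 2 , 0))
    ∷ ((0 , 1 , 1) ⇐ (0 , 0 , 1) , (0 , 1 , 0) , (0 , 1 , 2))
    ∷ ((0 , 0 , 2) ⇐ (0 , 1 , 2) , (0 , 0 , 1) , (0 , 0 , 3))
    ∷ ((1 , 1 , 2) ⇐ (0 , 1 , 2) , (1 , 2 , 2) , (1 , 1 , 3))
    ∷ ((0 , 1 , 3) ⇐ (1 , 1 , 3) , (0 , 0 , 3) , (0 , 1 , 2))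
    ∷ ((1 , 2 , 3) ⇐ (1 , 1 , 3) , (1 , 2 , 2) , (1 , 2 , 4))
    ∷ ((1 , 1 , 4) ⇐ (1 , 2 , 4) , (1 , 1 , 3) , (1 , 1 , 5))
    ∷ ((1 , 0 , 5) ⇐ (0 , 0 , 5) , (1 , 1 , 5) , (1 , 0 , 6))
    ∷ ((1 , 2 , 5) ⇐ (1 , 1 , 5) , (1 , 2 , 4) , (1 , 2 , 6))
    ∷ ((1 , 1 , 6) ⇐ (1 , 0 , 6) , (1 , 2 , 6) , (1 , 1 , 5))
    ∷ ((1 , 1 , 1) ⇐ (0 , 1 , 1) , (1 , 1 , 0) , (1 , 1 , 2))
    ∷ ((1 , 2 , 1) ⇐ (1 , 1 , 1) , (1 , 2 , 0) , (1 , 2 , 2))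
    ∷ ((1 , 0 , 1) ⇐ (0 , 0 , 1) , (1 , 1 , 1) , (1 , 0 , 0))
    ∷ ((1 , 0 , 2) ⇐ (0 , 0 , 2) , (1 , 1 , 2) , (1 , 0 , 1))
    ∷ ((1 , 0 , 3) ⇐ (0 , 0 , 3) , (1 , 1 , 3) , (1 , 0 , 2))
    ∷ ((1 , 0 , 4) ⇐ (1 , 1 , 4) , (1 , 0 , 3) , (1 , 0 , 5))
    ∷ ((0 , 0 , 4) ⇐ (1 , 0 , 4) , (0 , 0 , 3) , (0 , 0 , 5))
    ∷ ((0 , 1 , 4) ⇐ (1 , 1 , 4) , (0 , 0 , 4) , (0 , 1 , 3))
    ∷ ((0 , 1 , 5) ⇐ (1 , 1 , 5) , (0 , 0 , 5) , (0 , 1 , 4))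
    ∷ []) _ _

periodCertificate : Certificate {1} {2} 8
  (allButCorner ∷ row₁ ∷ upper 0 0 ∷ upper 0 1 ∷ upper 0 2 ∷ upper 0 3 ∷ upper 0 4 ∷ upper 0 5 ∷ [])
  (allButCorner ∷ allButCorner ∷ allButCorner ∷ allButCorner ∷ allButCorner ∷ allButCorner ∷ allButCorner ∷ row₁ ∷ [])
periodCertificate = certify _ _ _
  ( ((0 , 0 , 1) ⇐ (1 , 0 , 1) , (0 , 0 , 0) , (0 , 0 , 2))
    ∷ ((0 , 1 , 1) ⇐ (1 , 1 , 1) , (0 , 0 , 1) , (0 , 1 , 0))
    ∷ ((0 , 1 , 2) ⇐ (0 , 0 , 2) , (0 , 1 , 1) , (0 , 1 , 3))
    ∷ ((0 , 0 , 3) ⇐ (0 , 1 , 3) , (0 , 0 , 2) , (0 , 0 , 4))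
    ∷ ((1 , 1 , 3) ⇐ (0 , 1 , 3) , (1 , 2 , 3) , (1 , 1 , 4))
    ∷ ((0 , 1 , 4) ⇐ (1 , 1 , 4) , (0 , 0 , 4) , (0 , 1 , 3))
    ∷ ((1 , 2 , 4) ⇐ (1 , 1 , 4) , (1 , 2 , 3) , (1 , 2 , 5))
    ∷ ((1 , 1 , 5) ⇐ (1 , 2 , 5) , (1 , 1 , 4) , (1 , 1 , 6))
    ∷ ((1 , 0 , 6) ⇐ (0 , 0 , 6) , (1 , 1 , 6) , (1 , 0 , 7))
    ∷ ((1 , 2 , 6) ⇐ (1 , 1 , 6) , (1 , 2 , 5) , (1 , 2 , 7))
    ∷ ((1 , 1 , 7) ⇐ (1 , 0 , 7) , (1 , 2 , 7) , (1 , 1 , 6))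
    ∷ ((1 , 1 , 2) ⇐ (0 , 1 , 2) , (1 , 1 , 1) , (1 , 1 , 3))
    ∷ ((1 , 2 , 2) ⇐ (1 , 1 , 2) , (1 , 2 , 1) , (1 , 2 , 3))
    ∷ ((1 , 0 , 2) ⇐ (0 , 0 , 2) , (1 , 1 , 2) , (1 , 0 , 1))
    ∷ ((1 , 0 , 3) ⇐ (0 , 0 , 3) , (1 , 1 , 3) , (1 , 0 , 2))
    ∷ ((1 , 0 , 4) ⇐ (0 , 0 , 4) , (1 , 1 , 4) , (1 , 0 , 3))
    ∷ ((1 , 0 , 5) ⇐ (1 , 1 , 5) , (1 , 0 , 4) , (1 , 0 , 6))
    ∷ ((0 , 0 , 5) ⇐ (1 , 0 , 5) , (0 , 0 , 4) , (0 , 0 , 6))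
    ∷ ((0 , 1 , 5) ⇐ (1 , 1 , 5) , (0 , 0 , 5) , (0 , 1 , 4))
    ∷ ((0 , 1 , 6) ⇐ (1 , 1 , 6) , (0 , 0 , 6) , (0 , 1 , 5))
    ∷ []) _ _

topCertificate : Certificate {1} {2} 4
  (allButCorner ∷ row₁ ∷ top 0 ∷ top 1 ∷ [])
  (wholeLayer ∷ wholeLayer ∷ wholeLayer ∷ wholeLayer ∷ [])
topCertificate = certify _ _ _
  ( ((1 , 2 , 2) ⇐ (0 , 2 , 2) , (1 , 2 , 1) , (1 , 2 , 3))
    ∷ ((0 , 2 , 3) ⇐ (1 , 2 , 3) , (0 , 1 , 3) , (0 , 2 , 2))
    ∷ ((1 , 1 , 3) ⇐ (0 , 1 , 3) , (1 , 0 , 3) , (1 , 2 , 3))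
    ∷ ((1 , 1 , 2) ⇐ (1 , 2 , 2) , (1 , 1 , 1) , (1 , 1 , 3))
    ∷ ((0 , 1 , 2) ⇐ (1 , 1 , 2) , (0 , 2 , 2) , (0 , 1 , 3))
    ∷ ((1 , 0 , 2) ⇐ (1 , 1 , 2) , (1 , 0 , 1) , (1 , 0 , 3))
    ∷ ((0 , 1 , 1) ⇐ (1 , 1 , 1) , (0 , 1 , 0) , (0 , 1 , 2))
    ∷ ((0 , 2 , 1) ⇐ (1 , 2 , 1) , (0 , 1 , 1) , (0 , 2 , 2))
    ∷ ((0 , 2 , 0) ⇐ (1 , 2 , 0) , (0 , 1 , 0) , (0 , 2 , 1))
    ∷ ((0 , 0 , 1) ⇐ (1 , 0 , 1) , (0 , 1 , 1) , (0 , 0 , 0))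
    ∷ ((0 , 0 , 2) ⇐ (1 , 0 , 2) , (0 , 1 , 2) , (0 , 0 , 1))
    ∷ ((0 , 0 , 3) ⇐ (1 , 0 , 3) , (0 , 1 , 3) , (0 , 0 , 2))
    ∷ []) _ _

cornerCertificate : Certificate {1} {2} 2 (allButCorner ∷ corner ∷ []) (corner ∷ [])
cornerCertificate = certify _ _ _
  ( ((0 , 2 , 0) ⇐ (1 , 2 , 0) , (0 , 1 , 0) , (0 , 2 , 1))
    ∷ []) _ _

module Percolation (r : ℕ) where

  n s : ℕ
  n = 8 + r * 6
  s = 5 + r * 6

  A : VSet 2 3 (suc n)
  A = initialSet r

  initially-infected : ∀ k → k ≤ n → InfectedLayer A k (initialPattern r k)
  initially-infected k k≤n = All.tabulate λ {p} p∈P →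
    0 , subst (λ h → does ((clamp (proj₁ p) , clamp (proj₂ p)) ∈ₚ? positions (initialPattern r h)) ≡ true)
              (sym (toℕ-clamp k≤n)) (dec-true (_ ∈ₚ? _) (∈-map⁺ _ p∈P))

  period-height : ∀ {b o} → b + suc o ≡ r → ∀ i → i ≤ 5 → suc (6 + i + b * 6) ≤ n
  period-height {b} {o} b+1+o≡r i i≤5 = begin
    7 + i + b * 6            ≤⟨ +-monoˡ-≤ (b * 6) (+-monoʳ-≤ 7 i≤5) ⟩
    12 + b * 6               ≤⟨ m≤m+n (12 + b * 6) (2 + o * 6) ⟩
    12 + b * 6 + (2 + o * 6) ≡⟨ regroup b o ⟩
    8 + (b + suc o) * 6      ≡⟨ cong (λ q → 8 + q * 6) b+1+o≡r ⟩
    n                        ∎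
    where
    open ≤-Reasoning
    regroup : ∀ b o → 12 + b * 6 + (2 + o * 6) ≡ 8 + (b + suc o) * 6
    regroup = solve-∀

  period-layer : ∀ {b o} → b + suc o ≡ r → ∀ i → i ≤ 5 → InfectedLayer A (suc (6 + i + b * 6)) (upper o i)
  period-layer {b} {o} b+1+o≡r i i≤5 =
    subst (InfectedLayer A _) (trans (cong (λ q → upper q (6 + i + b * 6)) (sym b+1+o≡r)) (upper-periodic b (suc o) (6 + i)))
          (initially-infected _ (period-height b+1+o≡r i i≤5))

  top-layer : ∀ i → i ≤ 1 → InfectedLayer A (suc (6 + i + r * 6)) (top i)
  top-layer i i≤1 =
    subst (InfectedLayer A _) (trans (cong (λ q → upper q (6 + i + r * 6)) (sym (+-identityʳ r))) (upper-periodic r 0 (6 + i)))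
          (initially-infected _ (+-monoˡ-≤ (r * 6) (s≤s (+-monoʳ-≤ 6 (≤-trans i≤1 (s≤s z≤n))))))

  Swept : ℕ → Set
  Swept b = (∀ k → k ≤ 5 + b * 6 → InfectedLayer A k allButCorner) × InfectedLayer A (6 + b * 6) row₁

  swept-base : Swept 0
  swept-base =
    let f₀ , f₁ , f₂ , f₃ , f₄ , f₅ , row , _ =
          certificate-sound A baseCertificate (m≤m+n 7 _) (initial 0 , initial 1 , initial 2 , initial 3 ,
                                                          initial 4 , initial 5 , initial 6 , tt)
    in ≤-extend (≤-extend (≤-extend (≤-extend (≤-extend (≤-zero f₀) f₁) f₂) f₃) f₄) f₅ , row
    where
    initial : ∀ k → {k≤n : True (k ℕ.≤? n)} → InfectedLayer A k (initialPattern r k)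
    initial k {k≤n} = initially-infected k (toWitness k≤n)

  swept-step : ∀ b o → b + suc o ≡ r → Swept b → Swept (suc b)
  swept-step b o b+1+o≡r (below , row) =
    let _ , f₁ , f₂ , f₃ , f₄ , f₅ , f₆ , row′ , _ =
          certificate-sound A periodCertificate (s≤s (period-height b+1+o≡r 5 ≤-refl))
            (below (5 + b * 6) ≤-refl , row , block 0 , block 1 , block 2 , block 3 , block 4 , block 5 , tt)
    in ≤-extend (≤-extend (≤-extend (≤-extend (≤-extend (≤-extend below f₁) f₂) f₃) f₄) f₅) f₆ , row′
    where
    block : ∀ i {i≤5 : True (i ℕ.≤? 5)} → InfectedLayer A (suc (6 + i + b * 6)) (upper o i)
    block i {i≤5} = period-layer b+1+o≡r i (toWitness i≤5)

  swept : ∀ b → b ≤ r → Swept b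
  swept zero    _      = swept-base
  swept (suc b) 1+b≤r with m≤n⇒∃[o]m+o≡n 1+b≤r
  ... | o , 1+b+o≡r = swept-step b o (trans (+-suc b o) 1+b+o≡r) (swept b (≤-trans (n≤1+n b) 1+b≤r))

  allButCorner-below : ∀ k → k ≤ s → InfectedLayer A k allButCorner
  allButCorner-below = proj₁ (swept r ≤-refl)

  top-window : InfectedStack A s (wholeLayer ∷ wholeLayer ∷ wholeLayer ∷ wholeLayer ∷ [])
  top-window =
    certificate-sound A topCertificate ≤-refl
      (allButCorner-below s ≤-refl , proj₂ (swept r ≤-refl) , top-layer 0 z≤n , top-layer 1 (s≤s z≤n) , tt)

  corner-column : ∀ d k → k + d ≡ s → InfectedLayer A k corner
  corner-column zero    k k≡s = subst (λ h → InfectedLayer A h corner) (trans (sym k≡s) (+-identityʳ k))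
                                      (All.++⁻ʳ allButCorner (proj₁ top-window))
  corner-column (suc d) k k+1+d≡s =
    proj₁ (certificate-sound A cornerCertificate fits (allButCorner-below k k≤s , corner-column d (suc k) 1+k+d≡s , tt))
    where
    1+k+d≡s : suc k + d ≡ s
    1+k+d≡s = trans (sym (+-suc k d)) k+1+d≡s
    k≤s : k ≤ s
    k≤s = subst (k ≤_) k+1+d≡s (m≤m+n k (suc d))
    fits : 2 + k ≤ suc n
    fits = s≤s (s≤s (≤-trans k≤s (≤-trans (n≤1+n s) (n≤1+n (suc s)))))

  whole-layers : ∀ k → k ≤ n → InfectedLayer A k wholeLayer
  whole-layers = let _ , w₁ , w₂ , w₃ , _ = top-window in ≤-extend (≤-extend (≤-extend up-to-s w₁) w₂) w₃
    where
    up-to-s : ∀ k → k ≤ s → InfectedLayer A k wholeLayer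
    up-to-s k k≤s = All.++⁺ (allButCorner-below k k≤s) (corner-column (s ∸ k) k (m+[n∸m]≡n k≤s))

  ∈-wholeLayer : ∀ (x₁ : Fin 2) (x₂ : Fin 3) → (toℕ x₁ , toℕ x₂) ∈ wholeLayer
  ∈-wholeLayer fzero        fzero               = here refl
  ∈-wholeLayer fzero        (fsuc fzero)        = there (here refl)
  ∈-wholeLayer fzero        (fsuc (fsuc fzero)) = there (there (there (there (there (here refl)))))
  ∈-wholeLayer (fsuc fzero) fzero               = there (there (here refl))
  ∈-wholeLayer (fsuc fzero) (fsuc fzero)        = there (there (there (here refl)))
  ∈-wholeLayer (fsuc fzero) (fsuc (fsuc fzero)) = there (there (there (there (here refl))))

  percolates : Percolates A
  percolates (x₁ , x₂ , x₃) =
    subst (Infected A) (cong₂ _,_ (clamp-toℕ x₁) (cong₂ _,_ (clamp-toℕ x₂) (clamp-toℕ x₃)))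
          (All.lookup (whole-layers (toℕ x₃) (s≤s⁻¹ (Fin.toℕ<n x₃))) (∈-wholeLayer x₁ x₂))

perfect-2-3 : ∀ r → Perfect 2 3 (9 + r * 6)
perfect-2-3 r =
  divides m (surface≡m*3 r) ,
  (initialSet r , Percolation.percolates r , trans (size≡count (initialSet r)) (trans (count-initialSet r) (sym surface/3≡m))) ,
  λ B percolates → subst (_≤ size B) (sym surface/3≡m)
    (*-cancelˡ-≤ 3 (subst (_≤ 3 * size B) (trans (surface≡m*3 r) (*-comm m 3)) (percolating-set-lower-bound B percolates)))
  where
  m = 17 + r * 10
  surface≡m*3 : ∀ r → 2 * 3 + 2 * (9 + r * 6) + 3 * (9 + r * 6) ≡ (17 + r * 10) * 3
  surface≡m*3 = solve-∀
  surface/3≡m : (2 * 3 + 2 * (9 + r * 6) + 3 * (9 + r * 6)) / 3 ≡ m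
  surface/3≡m = trans (cong (_/ 3) (surface≡m*3 r)) (m*n/n≡m m 3)

m%6≡3⇒m≡9+r*6 : ∀ m → m ≥ 9 → m % 6 ≡ 3 → ∃[ r ] m ≡ 9 + r * 6
m%6≡3⇒m≡9+r*6 m m≥9 m%6≡3 with m / 6 | m≡m%n+[m/n]*n m 6
... | zero  | m≡m%6 = contradiction (subst (9 ≤_) (trans m≡m%6 (cong (_+ 0) m%6≡3)) m≥9) λ { (s≤s (s≤s (s≤s ()))) }
... | suc r | m≡m%6+[1+r]*6 = r , trans m≡m%6+[1+r]*6 (cong (_+ suc r * 6) m%6≡3)

proposition5p4 : (a₃ : ℕ) → a₃ ≥ 9 → a₃ % 6 ≡ 3 → Perfect 2 3 a₃
proposition5p4 a₃ a₃≥9 a₃%6≡3 with m%6≡3⇒m≡9+r*6 a₃ a₃≥9 a₃%6≡3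
... | r , refl = perfect-2-3 r
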